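{- Let $n\geq 2$. Then \[ \mathcal{E}(\mathrm{Red}_{\{1\}}) \cong Q_{n-1}\,\square\,(\mathcal{E}_{n-1})^{\square 2} \cong \coprod_{\mathcal{S}_1,\mathcal{S}_2\in\mathrm{Sig}(Q_{n-1})} Q_{n-1}\,\square\,\mathcal{E}(\mathcal{S}_1)\,\square\,\mathcal{E}(\mathcal{S}_2). \] Moreover, for $\mathcal{S}=(1,\mathcal{S}')\in\mathrm{Red}_{\{1\}}$ (where $\mathcal{S}'$ is an $(n-1)$-tuple) we have \[ \mathcal{E}(\mathcal{S}) \cong \coprod_{\substack{\mathcal{S}_1,\mathcal{S}_2\in\mathrm{Sig}(Q_{n-1})\\ \mathcal{S}_1+\mathcal{S}_2=\mathcal{S}'}} Q_{n-1}\,\square\,\mathcal{E}(\mathcal{S}_1)\,\square\,\mathcal{E}(\mathcal{S}_2). \]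
   Context: $[n]=\{1,\dots,n\}$. $Q_n$: vertices the subsets of $[n]$, edge between $X,Y$ iff $X\oplus Y=\{i\}$ for a single $i$ (the direction). $\sigma_i(X)=X\oplus\{i\}$. For a spanning tree $T$ and an edge $e\in T$ in direction $j\ne i$, if $\sigma_i(e)\notin T$ and $T-e+\sigma_i(e)$ is a spanning tree, this replacement is an edge slide. $\mathcal{E}_n$ is the graph on the spanning trees of $Q_n$ with adjacency given by single edge slides. $\mathrm{sig}(T)=(a_1,\dots,a_n)$ with $a_i$ the number of edges of $T$ in direction $i$; $\mathrm{Sig}(Q_n)$ is the set of such tuples; $\mathcal{E}(\mathcal{S})$ is the subgraph of $\mathcal{E}_n$ induced by trees of signature $\mathcal{S}$. $\mathrm{Red}_{\{1\}}$ is the set of signatures of $Q_n$ with $a_1=1$, and $\mathcal{E}(\mathrm{Red}_{\{1\}})=\bigcup_{\mathcal{S}\in\mathrm{Red}_{\{1\}}}\mathcal{E}(\mathcal{S})$. $\square$ is the Cartesian product of graphs (vertex set the product; $(u,v)\sim(u',v)$ for $uu'$ an edge, $(u,v)\sim(u,v')$ for $vv'$ an edge), $G^{\square 2}=G\square G$, $\coprod$ disjoint union; tuples are added entrywise. -}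

module Defs where

open import Level using (0ℓ)
open import Data.Nat using (ℕ; suc; _+_)
open import Data.Bool using (Bool; true; false; not; if_then_else_)
open import Data.Bool.Properties using () renaming (_≟_ to _≟B_)
open import Data.Fin using (Fin) renaming (_≟_ to _≟F_)
open import Data.Vec using (Vec; []; _∷_; lookup; tabulate; _[_]%=_; head; zipWith)
open import Data.Vec.Properties using () renaming (≡-dec to vec-≡-dec)
open import Data.List using (List; []; _∷_; _++_; map; length; filterᵇ)
open import Data.Product using (Σ; ∃; _×_; _,_; proj₁; proj₂)
open import Data.Product.Properties using () renaming (≡-dec to Σ-≡-dec)
open import Data.Product.Relation.Binary.Pointwise.NonDependent using (×-setoid)
open import Data.Sum using (_⊎_)
open import Relation.Nullary using (¬_; does)
open import Relation.Binary using (Setoid; DecidableEquality)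
open import Relation.Binary.PropositionalEquality
  using (_≡_; _≢_; refl; sym; trans; cong)
  renaming (setoid to ≡-setoid)
open import Relation.Binary.Construct.Closure.ReflexiveTransitive using (Star)
open import Function.Bundles using (Inverse; _⇔_)

-- The hypercube Q_n.  Direction i ∈ [n] is encoded by  i : Fin n
-- (paper's direction 1 is Fin.zero).  A vertex X ⊆ [n] is its
-- characteristic vector.

Vtx : ℕ → Set
Vtx n = Vec Bool n

σ : ∀ {n} → Fin n → Vtx n → Vtx n
σ i X = X [ i ]%= not

-- An edge {X, σ_i X} of Q_n is recorded as (i , X) where X is the
-- endpoint with i ∉ X (see IsEdge).  The pair (i , X) is an edge of Q_n
-- iff lookup X i ≡ false.
Edge : ℕ → Set
Edge n = Fin n × Vtx n

IsEdge : ∀ {n} → Edge n → Set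
IsEdge (i , X) = lookup X i ≡ false

dir : ∀ {n} → Edge n → Fin n
dir = proj₁

end₁ end₂ : ∀ {n} → Edge n → Vtx n
end₁ (i , X) = X
end₂ (i , X) = σ i X

_≟E_ : ∀ {n} → DecidableEquality (Edge n)
_≟E_ = Σ-≡-dec _≟F_ (vec-≡-dec _≟B_)

-- σ_i applied to an edge (translation of both endpoints; for i ≠ dir e
-- it again has lower endpoint σ_i X).
σE : ∀ {n} → Fin n → Edge n → Edge n
σE i (j , X) = (j , σ i X)

EdgeSet : ℕ → Set
EdgeSet n = Edge n → Bool

data Step {n} (T : EdgeSet n) : Vtx n → Vtx n → Set where
  fwd : ∀ {e} → T e ≡ true → Step T (end₁ e) (end₂ e)
  bwd : ∀ {e} → T e ≡ true → Step T (end₂ e) (end₁ e)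

Reach : ∀ {n} → EdgeSet n → Vtx n → Vtx n → Set
Reach T = Star (Step T)

remove : ∀ {n} → EdgeSet n → Edge n → EdgeSet n
remove T e x = if does (x ≟E e) then false else T x

swap : ∀ {n} → EdgeSet n → Edge n → Edge n → EdgeSet n
swap T e f x = if does (x ≟E f) then true else remove T e x

Connected : ∀ {n} → EdgeSet n → Set
Connected {n} T = ∀ (X Y : Vtx n) → Reach T X Y

-- acyclic (a forest): no edge of T lies on a cycle, i.e. the endpoints
-- of every edge e ∈ T are disconnected in T − e
Acyclic : ∀ {n} → EdgeSet n → Set
Acyclic {n} T = ∀ (e : Edge n) → T e ≡ true → ¬ Reach (remove T e) (end₁ e) (end₂ e)

IsSpanningTree : ∀ {n} → EdgeSet n → Set
IsSpanningTree {n} T =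
  (∀ (e : Edge n) → T e ≡ true → IsEdge e) × Connected T × Acyclic T

SpanningTree : ℕ → Set
SpanningTree n = Σ (EdgeSet n) IsSpanningTree

allVtx : ∀ n → List (Vtx n)
allVtx 0 = [] ∷ []
allVtx (suc n) = map (false ∷_) (allVtx n) ++ map (true ∷_) (allVtx n)

sig : ∀ {n} → EdgeSet n → Vec ℕ n
sig {n} T = tabulate (λ i → length (filterᵇ (λ X → T (i , X)) (allVtx n)))

InSig : ∀ n → Vec ℕ n → Set
InSig n S = Σ (SpanningTree n) (λ T → sig (proj₁ T) ≡ S)

InRed1 : ∀ m → Vec ℕ (suc m) → Set
InRed1 m S = InSig (suc m) S × head S ≡ 1

record Graph : Set₁ where
  field
    setoid : Setoid 0ℓ 0ℓ
  open Setoid setoid public using (Carrier; _≈_)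
  field
    Adj : Carrier → Carrier → Set

open Graph

record _≅_ (G H : Graph) : Set where
  field
    bij : Inverse (setoid G) (setoid H)
  open Inverse bij public using (to; from)
  field
    adj : ∀ u v → Adj G u v ⇔ Adj H (to u) (to v)

infix 4 _≅_

_□_ : Graph → Graph → Graph
G □ H = record
  { setoid = ×-setoid (setoid G) (setoid H)
  ; Adj = λ { (u , v) (u′ , v′) →
        (Adj G u u′ × _≈_ H v v′) ⊎ (_≈_ G u u′ × Adj H v v′) }
  }

infixr 6 _□_

Induced : (G : Graph) → (Carrier G → Set) → Graph
Induced G P = record
  { setoid = record
      { Carrier = Σ (Carrier G) P
      ; _≈_ = λ a b → _≈_ G (proj₁ a) (proj₁ b)
      ; isEquivalence = record
          { refl = Setoid.refl (setoid G)
          ; sym = Setoid.sym (setoid G)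
          ; trans = Setoid.trans (setoid G) } }
  ; Adj = λ a b → Adj G (proj₁ a) (proj₁ b)
  }

-- Disjoint union  ∐_{k ∈ K, P k} G k  (the proof of P k is irrelevant:
-- one copy of G k for every k satisfying P)
module _ (K : Set) (P : K → Set) (G : K → Graph) where
  CV : Set
  CV = Σ K (λ k → P k × Carrier (G k))

  data CEq : CV → CV → Set where
    ceq : ∀ {k p p′ x y} → _≈_ (G k) x y → CEq (k , p , x) (k , p′ , y)

  data CAdj : CV → CV → Set where
    cadj : ∀ {k p p′ x y} → Adj (G k) x y → CAdj (k , p , x) (k , p′ , y)

  private
    crefl : ∀ {a} → CEq a a
    crefl {k , p , x} = ceq (Setoid.refl (setoid (G k)))
    csym : ∀ {a b} → CEq a b → CEq b a
    csym (ceq {k} e) = ceq (Setoid.sym (setoid (G k)) e)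
    ctrans : ∀ {a b c} → CEq a b → CEq b c → CEq a c
    ctrans (ceq {k} e) (ceq f) = ceq (Setoid.trans (setoid (G k)) e f)

  Coprod : Graph
  Coprod = record
    { setoid = record
        { Carrier = CV ; _≈_ = CEq
        ; isEquivalence = record { refl = crefl ; sym = csym ; trans = ctrans } }
    ; Adj = CAdj }

Q : ℕ → Graph
Q n = record
  { setoid = ≡-setoid (Vtx n)
  ; Adj = λ X Y → ∃ (λ i → Y ≡ σ i X) }

-- T′ is obtained from T by a single edge slide:
-- e ∈ T in direction j ≠ i, σ_i(e) ∉ T, T′ = T − e + σ_i(e)
-- (that T′ is a spanning tree is part of T′ being a vertex of ℰ_n)
Slide : ∀ {n} → EdgeSet n → EdgeSet n → Set
Slide {n} T T′ = Σ (Fin n) λ i → Σ (Edge n) λ e →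
  (dir e ≢ i) × (T e ≡ true) × (T (σE i e) ≡ false) ×
  (∀ x → T′ x ≡ swap T e (σE i e) x)

ℰ : ℕ → Graph
ℰ n = record
  { setoid = record
      { Carrier = SpanningTree n
      ; _≈_ = λ T T′ → ∀ x → proj₁ T x ≡ proj₁ T′ x
      ; isEquivalence = record
          { refl = λ x → refl
          ; sym = λ p x → sym (p x)
          ; trans = λ p q x → trans (p x) (q x) } }
  ; Adj = λ T T′ → Slide (proj₁ T) (proj₁ T′) ⊎ Slide (proj₁ T′) (proj₁ T)
  }

ℰS : ∀ n → Vec ℕ n → Graph
ℰS n S = Induced (ℰ n) (λ T → sig (proj₁ T) ≡ S)

-- ℰ(Red_{1}) = ⋃_{S ∈ Red_{1}} ℰ(S)  for Q_{suc m}
-- (the ℰ(S) are vertex-disjoint, so the union is their disjoint union)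
ℰRed1 : ∀ m → Graph
ℰRed1 m = Coprod (Vec ℕ (suc m)) (InRed1 m) (ℰS (suc m))

_+ᵛ_ : ∀ {n} → Vec ℕ n → Vec ℕ n → Vec ℕ n
_+ᵛ_ = zipWith _+_

module Submission where

-- A spanning tree T of Q_{m+1} with a single edge in direction 1 is that "bridge" edge
-- {0X₀, 1X₀} together with two spanning trees A, B of the faces x₁ = 0 and x₁ = 1: a cycle
-- of a face would be a cycle of T, and retracting the cube onto a face (collapsing the other
-- face to X₀) turns paths of T into paths of that face. Conversely every triple (X₀, A, B)
-- glues to such a tree, with sig T = (1, sig A + sig B). Under this bijection an edge slide
-- of T is either a slide of the bridge to σ_i X₀, i.e. an edge of Q_m, or an edge slide
-- inside A or inside B; a face edge cannot slide across direction 1, since the other face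
-- already joins its endpoints. This gives ℰ(Red_{1}) ≅ Q_m □ ℰ_m □ ℰ_m, and sorting the
-- pairs (A, B) by their signatures gives the two disjoint-union decompositions.

open import Defs
open import Data.Bool using (Bool; true; false; not; if_then_else_)
open import Data.Bool.Properties using (not-involutive; not-¬; ¬-not) renaming (_≟_ to _≟B_)
open import Data.Empty using (⊥; ⊥-elim)
open import Data.Fin using (Fin; zero; suc) renaming (_≟_ to _≟F_)
import Data.Fin.Properties as Fin
open import Data.List using (List; []; _∷_; _++_; map; length; filterᵇ)
open import Data.List.Properties using (length-++; filter-++)
open import Data.Nat using (ℕ; zero; suc; _+_; _≤_)
open import Data.Nat.Properties using (+-comm; suc-injective; 0≢1+n)
open import Data.Product using (∃; _×_; _,_; proj₁; proj₂)
open import Data.Sum using (_⊎_; inj₁; inj₂)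
import Data.Sum as Sum
open import Data.Unit using (⊤; tt)
open import Data.Vec using (Vec; []; _∷_; head; tail; lookup; tabulate; zipWith)
open import Data.Vec.Properties
  using (tabulate-cong; ∷-injectiveˡ; ∷-injectiveʳ; updateAt-updateAt; updateAt-id-local; lookup∘updateAt)
  renaming (≡-dec to ≡-decᵛ)
open import Function using (id; _∘_; case_of_)
open import Function.Bundles using (_⇔_; mk⇔)
import Function.Construct.Composition as Compose
open import Function.Definitions using (Injective)
import Function.Properties.Equivalence as ⇔
open import Relation.Binary using (DecidableEquality; Symmetric)
open import Relation.Binary.Construct.Closure.ReflexiveTransitive as Star
  using (Star; ε; _◅_; _◅◅_; kleisliStar)
open import Relation.Binary.PropositionalEquality
open import Relation.Nullary using (Dec; does; yes; no)
open import Relation.Nullary.Decidable using (dec-true; dec-false)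

open Graph using (Carrier; Adj)

-- Isomorphisms of graphs

≅-trans : ∀ {G H K} → G ≅ H → H ≅ K → G ≅ K
≅-trans φ ψ = record
  { bij = Compose.inverse (_≅_.bij φ) (_≅_.bij ψ)
  ; adj = λ u v → ⇔.trans (_≅_.adj φ u v) (_≅_.adj ψ _ _)
  }

module _ (G : Graph) {P : Carrier G → Set} (all : ∀ x → P x) where

  Induced-total-≅ : Induced G P ≅ G
  Induced-total-≅ = record
    { bij = record { to = proj₁ ; from = λ x → x , all x ; to-cong = id ; from-cong = id ; inverse = id , id }
    ; adj = λ _ _ → ⇔.refl
    }

  ≅-Induced-total : G ≅ Induced G P
  ≅-Induced-total = record
    { bij = record { to = λ x → x , all x ; from = proj₁ ; to-cong = id ; from-cong = id ; inverse = id , id }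
    ; adj = λ _ _ → ⇔.refl
    }

module _ (G : Graph) {K : Set} (f : Carrier G → K) (P : K → Set)
         (f-cong : ∀ {x y} → Graph._≈_ G x y → f x ≡ f y) (f-adj : ∀ {x y} → Adj G x y → f x ≡ f y) where

  private
    Fibre : K → Graph
    Fibre k = Induced G (λ x → f x ≡ k)

    fibre-≈ : ∀ {k k′ p p′ x y} {e : f x ≡ k} {e′ : f y ≡ k′} →
      k ≡ k′ → Graph._≈_ G x y → CEq K P Fibre (k , p , (x , e)) (k′ , p′ , (y , e′))
    fibre-≈ refl = ceq

    fibre-adj : ∀ {k k′ p p′ x y} {e : f x ≡ k} {e′ : f y ≡ k′} →
      k ≡ k′ → Adj G x y → CAdj K P Fibre (k , p , (x , e)) (k′ , p′ , (y , e′))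
    fibre-adj refl = cadj

    underlying : CV K P Fibre → Carrier G
    underlying (_ , _ , (x , _)) = x

    underlying-≈ : ∀ {a b} → CEq K P Fibre a b → Graph._≈_ G (underlying a) (underlying b)
    underlying-≈ (ceq r) = r

    underlying-adj : ∀ {a b} → CAdj K P Fibre a b → Adj G (underlying a) (underlying b)
    underlying-adj (cadj r) = r

  fibres-≅ : Coprod K P Fibre ≅ Induced G (P ∘ f)
  fibres-≅ = record
    { bij = record
      { to = λ (k , p , (x , e)) → x , subst P (sym e) p
      ; from = λ (x , p) → f x , p , (x , refl)
      ; to-cong = underlying-≈
      ; from-cong = λ r → fibre-≈ (f-cong r) r
      ; inverse = underlying-≈ , λ { {k , p , (x , e)} r → fibre-≈ (trans (f-cong r) e) r }
      }
    ; adj = λ where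
        (k , p , (x , e)) (k′ , p′ , (y , e′)) →
          mk⇔ underlying-adj λ r → fibre-adj (trans (sym e) (trans (f-adj r) e′)) r
    }

-- Counting vertices of the cube

module _ {A : Set} where

  filterᵇ-cong : {p q : A → Bool} → p ≗ q → filterᵇ p ≗ filterᵇ q
  filterᵇ-cong p≗q [] = refl
  filterᵇ-cong {p} {q} p≗q (x ∷ xs) with p x | q x | p≗q x
  ... | true  | .true  | refl = cong (x ∷_) (filterᵇ-cong p≗q xs)
  ... | false | .false | refl = filterᵇ-cong p≗q xs

  length-filterᵇ-map : ∀ {B : Set} (p : B → Bool) (f : A → B) xs →
    length (filterᵇ p (map f xs)) ≡ length (filterᵇ (p ∘ f) xs)
  length-filterᵇ-map p f [] = refl
  length-filterᵇ-map p f (x ∷ xs) with p (f x)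
  ... | true  = cong suc (length-filterᵇ-map p f xs)
  ... | false = length-filterᵇ-map p f xs

  length-filterᵇ-false : ∀ (xs : List A) → length (filterᵇ (λ _ → false) xs) ≡ 0
  length-filterᵇ-false [] = refl
  length-filterᵇ-false (x ∷ xs) = length-filterᵇ-false xs

  filterᵇ-witness : ∀ (p : A → Bool) xs {k} → length (filterᵇ p xs) ≡ suc k → ∃ λ x → p x ≡ true
  filterᵇ-witness p (x ∷ xs) eq with p x in px
  ... | true  = x , px
  ... | false = filterᵇ-witness p xs eq

infix 4 _≟V_
_≟V_ : ∀ {n} → DecidableEquality (Vtx n)
_≟V_ = ≡-decᵛ _≟B_

count : ∀ {n} → (Vtx n → Bool) → ℕ
count {n} p = length (filterᵇ p (allVtx n))

count-cong : ∀ {n} {p q : Vtx n → Bool} → p ≗ q → count p ≡ count q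
count-cong {n} p≗q = cong length (filterᵇ-cong p≗q (allVtx n))

count-suc : ∀ {n} (p : Vtx (suc n) → Bool) → count p ≡ count (p ∘ (false ∷_)) + count (p ∘ (true ∷_))
count-suc {n} p = begin
  length (filterᵇ p (map (false ∷_) (allVtx n) ++ map (true ∷_) (allVtx n)))
    ≡⟨ cong length (filter-++ _ (map (false ∷_) (allVtx n)) _) ⟩
  length (filterᵇ p (map (false ∷_) (allVtx n)) ++ filterᵇ p (map (true ∷_) (allVtx n)))
    ≡⟨ length-++ (filterᵇ p (map (false ∷_) (allVtx n))) ⟩
  length (filterᵇ p (map (false ∷_) (allVtx n))) + length (filterᵇ p (map (true ∷_) (allVtx n)))
    ≡⟨ cong₂ _+_ (length-filterᵇ-map p _ (allVtx n)) (length-filterᵇ-map p _ (allVtx n)) ⟩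
  count (p ∘ (false ∷_)) + count (p ∘ (true ∷_)) ∎
  where open ≡-Reasoning

count-split : ∀ {n} b (p : Vtx (suc n) → Bool) → count p ≡ count (p ∘ (b ∷_)) + count (p ∘ (not b ∷_))
count-split false p = count-suc p
count-split true p = trans (count-suc p) (+-comm (count (p ∘ (false ∷_))) _)

count-≡-suc : ∀ {n} {p q : Vtx n → Bool} X → p X ≡ true → q X ≡ false →
  (∀ Z → Z ≢ X → p Z ≡ q Z) → count p ≡ suc (count q)
count-≡-suc {zero} {p} {q} [] pX qX _ rewrite pX | qX = refl
count-≡-suc {suc n} {p} {q} (b ∷ X) pX qX agree = begin
  count p                                           ≡⟨ count-split b p ⟩
  count (p ∘ (b ∷_)) + count (p ∘ (not b ∷_))       ≡⟨ cong₂ _+_ inFace otherFace ⟩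
  suc (count (q ∘ (b ∷_)) + count (q ∘ (not b ∷_))) ≡⟨ cong suc (count-split b q) ⟨
  suc (count q)                                     ∎
  where
  open ≡-Reasoning
  inFace : count (p ∘ (b ∷_)) ≡ suc (count (q ∘ (b ∷_)))
  inFace = count-≡-suc X pX qX λ Z Z≢X → agree (b ∷ Z) (Z≢X ∘ ∷-injectiveʳ)
  otherFace : count (p ∘ (not b ∷_)) ≡ count (q ∘ (not b ∷_))
  otherFace = count-cong λ Z → agree (not b ∷ Z) (not-¬ refl ∘ sym ∘ ∷-injectiveˡ)

count-≟ : ∀ {n} (X : Vtx n) → count (λ Z → does (Z ≟V X)) ≡ 1
count-≟ {n} X = trans
  (count-≡-suc {q = λ _ → false} X (dec-true (X ≟V X) refl) refl (λ Z → dec-false (Z ≟V X)))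
  (cong suc (length-filterᵇ-false (allVtx n)))

_without_ : ∀ {n} → (Vtx n → Bool) → Vtx n → Vtx n → Bool
(p without X) Z = if does (Z ≟V X) then false else p Z

without-self : ∀ {n} (p : Vtx n → Bool) X → (p without X) X ≡ false
without-self p X rewrite dec-true (X ≟V X) refl = refl

without-≢ : ∀ {n} (p : Vtx n → Bool) {X Z} → Z ≢ X → (p without X) Z ≡ p Z
without-≢ p {X} {Z} Z≢X rewrite dec-false (Z ≟V X) Z≢X = refl

count-without : ∀ {n} (p : Vtx n → Bool) {X} → p X ≡ true → count p ≡ suc (count (p without X))
count-without p {X} pX = count-≡-suc X pX (without-self p X) (λ Z Z≢X → sym (without-≢ p Z≢X))

count≡1-unique : ∀ {n} {p : Vtx n → Bool} {X Y} → count p ≡ 1 → p X ≡ true → p Y ≡ true → X ≡ Y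
count≡1-unique {p = p} {X} {Y} one pX pY with Y ≟V X
... | yes Y≡X = sym Y≡X
... | no Y≢X =
  ⊥-elim (0≢1+n (trans (sym nothingElse) (count-without (p without X) (trans (without-≢ p Y≢X) pY))))
  where nothingElse : count (p without X) ≡ 0
        nothingElse = suc-injective (trans (sym (count-without p pX)) one)

count-swap : ∀ {n} {p q : Vtx n → Bool} {X Y} →
  p X ≡ true → q X ≡ false → p Y ≡ false → q Y ≡ true →
  (∀ Z → Z ≢ X → Z ≢ Y → p Z ≡ q Z) → count p ≡ count q
count-swap {p = p} {q} {X} {Y} pX qX pY qY agree = begin
  count p                   ≡⟨ count-without p pX ⟩
  suc (count (p without X)) ≡⟨ cong suc (count-cong same) ⟩
  suc (count (q without Y)) ≡⟨ count-without q qY ⟨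
  count q                   ∎
  where
  open ≡-Reasoning
  same : p without X ≗ q without Y
  same Z = byCases (Z ≟V X) (Z ≟V Y)
    where
    byCases : Dec (Z ≡ X) → Dec (Z ≡ Y) → (p without X) Z ≡ (q without Y) Z
    byCases (yes refl) (yes refl) = trans (without-self p Z) (sym (without-self q Z))
    byCases (yes refl) (no Z≢Y) = trans (without-self p Z) (sym (trans (without-≢ q Z≢Y) qX))
    byCases (no Z≢X) (yes refl) = trans (without-≢ p Z≢X) (trans pY (sym (without-self q Z)))
    byCases (no Z≢X) (no Z≢Y) = trans (without-≢ p Z≢X) (trans (agree Z Z≢X Z≢Y) (sym (without-≢ q Z≢Y)))

zipWith-tabulate : ∀ {n} {A B C : Set} (_∙_ : A → B → C) (f : Fin n → A) (g : Fin n → B) →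
  zipWith _∙_ (tabulate f) (tabulate g) ≡ tabulate (λ i → f i ∙ g i)
zipWith-tabulate {zero} _∙_ f g = refl
zipWith-tabulate {suc n} _∙_ f g = cong (f zero ∙ g zero ∷_) (zipWith-tabulate _∙_ (f ∘ suc) (g ∘ suc))

-- Edge sets and edge slides

σ-involutive : ∀ {n} (i : Fin n) (X : Vtx n) → σ i (σ i X) ≡ X
σ-involutive i X = trans (updateAt-updateAt i X) (updateAt-id-local i X (not-involutive _))

σ-irreflexive : ∀ {n} (i : Fin n) (X : Vtx n) → σ i X ≢ X
σ-irreflexive i X σX≡X = not-¬ refl (trans (sym (cong (λ Z → lookup Z i) σX≡X)) (lookup∘updateAt i X))

Q-symmetric : ∀ {n} → Symmetric (Adj (Q n))
Q-symmetric {x = X} (i , refl) = i , sym (σ-involutive i X)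

module _ {n} (T : EdgeSet n) where

  remove-self : ∀ e → remove T e e ≡ false
  remove-self e rewrite dec-true (e ≟E e) refl = refl

  remove-other : ∀ {e x} → x ≢ e → remove T e x ≡ T x
  remove-other {e} {x} x≢e rewrite dec-false (x ≟E e) x≢e = refl

  remove-true : ∀ {e x} → remove T e x ≡ true → x ≢ e × T x ≡ true
  remove-true {e} {x} r with x ≟E e
  ... | no x≢e = x≢e , r

  swap-new : ∀ e f → swap T e f f ≡ true
  swap-new e f rewrite dec-true (f ≟E f) refl = refl

  swap-away : ∀ {e f x} → x ≢ f → swap T e f x ≡ remove T e x
  swap-away {e} {f} {x} x≢f rewrite dec-false (x ≟E f) x≢f = refl

  swap-old : ∀ {e f} → e ≢ f → swap T e f e ≡ false
  swap-old {e} e≢f = trans (swap-away e≢f) (remove-self e)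

  swap-other : ∀ {e f x} → x ≢ e → x ≢ f → swap T e f x ≡ T x
  swap-other x≢e x≢f = trans (swap-away x≢f) (remove-other x≢e)

  swap-true : ∀ {e f x} → swap T e f x ≡ true → x ≡ f ⊎ (x ≢ e × T x ≡ true)
  swap-true {e} {f} {x} s with x ≟E f
  ... | yes x≡f = inj₁ x≡f
  ... | no _ = inj₂ (remove-true s)

  slide-new : ∀ {T′ : EdgeSet n} {e f} → T′ ≗ swap T e f → T′ f ≡ true
  slide-new {e = e} {f} T′≗ = trans (T′≗ f) (swap-new e f)

  slide-away : ∀ {T′ : EdgeSet n} {e f x} → T′ ≗ swap T e f → x ≢ e → x ≢ f → T′ x ≡ T x
  slide-away T′≗ x≢e x≢f = trans (T′≗ _) (swap-other x≢e x≢f)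

module _ {m n} {ι : Edge m → Edge n} (ι-injective : Injective _≡_ _≡_ ι) (T : EdgeSet n) where

  remove-∘ : ∀ e x → remove T (ι e) (ι x) ≡ remove (T ∘ ι) e x
  remove-∘ e x = case x ≟E e of λ where
    (yes refl) → trans (remove-self T (ι e)) (sym (remove-self (T ∘ ι) e))
    (no x≢e) → trans (remove-other T (x≢e ∘ ι-injective)) (sym (remove-other (T ∘ ι) x≢e))

  swap-∘ : ∀ e f x → swap T (ι e) (ι f) (ι x) ≡ swap (T ∘ ι) e f x
  swap-∘ e f x = case x ≟E f of λ where
    (yes refl) → trans (swap-new T (ι e) (ι f)) (sym (swap-new (T ∘ ι) e f))
    (no x≢f) → trans (swap-away T (x≢f ∘ ι-injective)) (trans (remove-∘ e x) (sym (swap-away (T ∘ ι) x≢f)))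

sig-cong : ∀ {n} {T T′ : EdgeSet n} → T ≗ T′ → sig T ≡ sig T′
sig-cong T≗T′ = tabulate-cong λ i → count-cong λ X → T≗T′ (i , X)

slide-preserves-sig : ∀ {n} {T T′ : EdgeSet n} → Slide T T′ → sig T ≡ sig T′
slide-preserves-sig {T = T} {T′} (i , (j , X) , _ , Te , Tf , T′≗) = tabulate-cong sameCount
  where
  e≢f : (j , X) ≢ (j , σ i X)
  e≢f e≡f = case trans (sym Te) (trans (cong T e≡f) Tf) of λ ()
  sameCount : ∀ k → count (λ Y → T (k , Y)) ≡ count (λ Y → T′ (k , Y))
  sameCount k = case k ≟F j of λ where
    (yes refl) → count-swap {p = λ Y → T (k , Y)} {q = λ Y → T′ (k , Y)}
                   Te (trans (T′≗ (j , X)) (swap-old T e≢f)) Tf (slide-new T T′≗)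
                   λ Z Z≢X Z≢σX → sym (slide-away T T′≗ (Z≢X ∘ cong proj₂) (Z≢σX ∘ cong proj₂))
    (no k≢j) → count-cong λ Y → sym (slide-away T {x = k , Y} T′≗ (k≢j ∘ cong proj₁) (k≢j ∘ cong proj₁))

ℰ-adjacent-sig : ∀ {n} (T T′ : SpanningTree n) → Adj (ℰ n) T T′ → sig (proj₁ T) ≡ sig (proj₁ T′)
ℰ-adjacent-sig _ _ (inj₁ s) = slide-preserves-sig s
ℰ-adjacent-sig _ _ (inj₂ s) = sym (slide-preserves-sig s)

-- Faces and paths

inFace : ∀ {m} → Bool → Edge m → Edge (suc m)
inFace b (j , Y) = suc j , b ∷ Y

inFace-injective : ∀ {m} b → Injective _≡_ _≡_ (inFace {m} b)
inFace-injective b refl = refl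

inFace-≢ : ∀ {m} {b c} {x y : Edge m} → b ≢ c → inFace b x ≢ inFace c y
inFace-≢ b≢c = b≢c ∘ cong (head ∘ proj₂)

face : ∀ {m} → Bool → EdgeSet (suc m) → EdgeSet m
face b T = T ∘ inFace b

sig-suc : ∀ {m} (T : EdgeSet (suc m)) →
  sig T ≡ count (λ W → T (zero , W)) ∷ (sig (face false T) +ᵛ sig (face true T))
sig-suc T = cong (count (λ W → T (zero , W)) ∷_)
  (trans (tabulate-cong λ k → count-suc (λ W → T (suc k , W))) (sym (zipWith-tabulate _+_ _ _)))

module _ {n} {S : EdgeSet n} where

  Step-sym : ∀ {u v} → Step S u v → Step S v u
  Step-sym (fwd s) = bwd s
  Step-sym (bwd s) = fwd s

  reach-mono : ∀ {S′ : EdgeSet n} → (∀ e → S e ≡ true → S′ e ≡ true) →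
    ∀ {u v} → Reach S u v → Reach S′ u v
  reach-mono S⊆S′ = Star.map λ where
    (fwd s) → fwd (S⊆S′ _ s)
    (bwd s) → bwd (S⊆S′ _ s)

module _ {m} {S : EdgeSet m} {T : EdgeSet (suc m)} (b : Bool) where

  lift-reach : (∀ e → S e ≡ true → T (inFace b e) ≡ true) → ∀ {X Y} → Reach S X Y → Reach T (b ∷ X) (b ∷ Y)
  lift-reach S⊆face = Star.gmap (b ∷_) λ where
    (fwd {e} s) → fwd {e = inFace b e} (S⊆face e s)
    (bwd {e} s) → bwd {e = inFace b e} (S⊆face e s)

OnlyBridge : ∀ {m} → EdgeSet (suc m) → Vtx m → Set
OnlyBridge T X₀ = ∀ W → T (zero , W) ≡ true → W ≡ false ∷ X₀

record Bridge {m} (T : EdgeSet (suc m)) (X₀ : Vtx m) : Set where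
  constructor mkBridge
  field
    edge : T (zero , false ∷ X₀) ≡ true
    unique : OnlyBridge T X₀

-- The retraction of the cube onto the face x₁ = b that collapses the other face to X₀.
project : ∀ {m} → Bool → Vtx m → Vtx (suc m) → Vtx m
project false X₀ (false ∷ Y) = Y
project false X₀ (true ∷ Y) = X₀
project true X₀ (false ∷ Y) = X₀
project true X₀ (true ∷ Y) = Y

project-same : ∀ {m} b (X₀ Y : Vtx m) → project b X₀ (b ∷ Y) ≡ Y
project-same false X₀ Y = refl
project-same true X₀ Y = refl

module _ {m} {S : EdgeSet (suc m)} {X₀ : Vtx m} (only : OnlyBridge S X₀) (b : Bool) where

  private
    π = project b X₀

  project-edge : ∀ e → S e ≡ true → π (end₁ e) ≡ π (end₂ e) ⊎ Step (face b S) (π (end₁ e)) (π (end₂ e))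
  project-edge (zero , W) s with refl ← only W s = inj₁ (bridge-collapses b)
    where bridge-collapses : ∀ b → project b X₀ (false ∷ X₀) ≡ project b X₀ (true ∷ X₀)
          bridge-collapses false = refl
          bridge-collapses true = refl
  project-edge (suc j , c ∷ Y) s = face-or-other b c s
    where face-or-other : ∀ b c → S (suc j , c ∷ Y) ≡ true →
            project b X₀ (c ∷ Y) ≡ project b X₀ (c ∷ σ j Y) ⊎
            Step (face b S) (project b X₀ (c ∷ Y)) (project b X₀ (c ∷ σ j Y))
          face-or-other false false s = inj₂ (fwd {e = j , Y} s)
          face-or-other false true s = inj₁ refl
          face-or-other true false s = inj₁ refl
          face-or-other true true s = inj₂ (fwd {e = j , Y} s)

  private
    step-or-stay : ∀ {u v} → π u ≡ π v ⊎ Step (face b S) (π u) (π v) → Reach (face b S) (π u) (π v)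
    step-or-stay (inj₁ πu≡πv) = subst (Reach (face b S) (π _)) πu≡πv ε
    step-or-stay (inj₂ s) = s ◅ ε

  project-reach : ∀ {u v} → Reach S u v → Reach (face b S) (π u) (π v)
  project-reach = kleisliStar π λ where
    (fwd {e} s) → step-or-stay (project-edge e s)
    (bwd {e} s) → Star.reverse Step-sym (step-or-stay (project-edge e s))

head-invariant : ∀ {m} {S : EdgeSet (suc m)} → (∀ W → S (zero , W) ≢ true) →
  ∀ {u v} → Reach S u v → head u ≡ head v
head-invariant none ε = refl
head-invariant none (fwd {zero , W} s ◅ p) = ⊥-elim (none W s)
head-invariant none (bwd {zero , W} s ◅ p) = ⊥-elim (none W s)
head-invariant none (fwd {suc j , c ∷ Y} s ◅ p) = head-invariant none p
head-invariant none (bwd {suc j , c ∷ Y} s ◅ p) = head-invariant none p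

-- Bridged spanning trees and gluing

module _ {m} {T : EdgeSet (suc m)} where

  face-connected : ∀ {X₀} → Connected T → OnlyBridge T X₀ → ∀ b → Connected (face b T)
  face-connected {X₀} connected only b X Y =
    subst₂ (Reach (face b T)) (project-same b X₀ X) (project-same b X₀ Y)
      (project-reach only b (connected (b ∷ X) (b ∷ Y)))

  face-acyclic : Acyclic T → ∀ b → Acyclic (face b T)
  face-acyclic acyclic b (j , X) t cycle = acyclic (inFace b (j , X)) t
    (lift-reach b (λ e r → trans (remove-∘ (inFace-injective b) T (j , X) e) r) cycle)

  face-isSpanningTree : ∀ {X₀} → IsSpanningTree T → OnlyBridge T X₀ → ∀ b → IsSpanningTree (face b T)
  face-isSpanningTree (edges , connected , acyclic) only b =
    (λ e → edges (inFace b e)) , face-connected connected only b , face-acyclic acyclic b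

  bridge-connected : ∀ {X₀} → T (zero , false ∷ X₀) ≡ true → (∀ b → Connected (face b T)) → Connected T
  bridge-connected {X₀} present connected (c ∷ X) (d ∷ Y) =
    lift-reach c (λ _ t → t) (connected c X X₀) ◅◅ cross c d ◅◅ lift-reach d (λ _ t → t) (connected d X₀ Y)
    where cross : ∀ c d → Reach T (c ∷ X₀) (d ∷ X₀)
          cross false false = ε
          cross false true = fwd {e = zero , false ∷ X₀} present ◅ ε
          cross true false = bwd {e = zero , false ∷ X₀} present ◅ ε
          cross true true = ε

  bridge-acyclic : ∀ {X₀} → OnlyBridge T X₀ → (∀ b → Acyclic (face b T)) → Acyclic T
  bridge-acyclic {X₀} only acyclic (zero , W) t cycle with refl ← only W t =
    case head-invariant noZeroEdge cycle of λ ()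
    where noZeroEdge : ∀ W′ → remove T (zero , false ∷ X₀) (zero , W′) ≢ true
          noZeroEdge W′ r = let (≢bridge , t′) = remove-true T r in ≢bridge (cong (zero ,_) (only W′ t′))
  bridge-acyclic {X₀} only acyclic (suc j , b ∷ X) t cycle = acyclic b (j , X) t
    (reach-mono (λ e r → trans (sym (remove-∘ (inFace-injective b) T (j , X) e)) r)
      (subst₂ (Reach _) (project-same b X₀ X) (project-same b X₀ (σ j X))
        (project-reach onlyRemoved b cycle)))
    where onlyRemoved : OnlyBridge (remove T (suc j , b ∷ X)) X₀
          onlyRemoved W r = only W (proj₂ (remove-true T {e = suc j , b ∷ X} r))

glue : ∀ {m} → Vtx m → EdgeSet m → EdgeSet m → EdgeSet (suc m)
glue X₀ A B (zero , W) = does (W ≟V false ∷ X₀)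
glue X₀ A B (suc k , c ∷ Z) = (if c then B else A) (k , Z)

≗-by-parts : ∀ {m} {T T′ : EdgeSet (suc m)} →
  (∀ W → T (zero , W) ≡ T′ (zero , W)) → (∀ b → face b T ≗ face b T′) → T ≗ T′
≗-by-parts zeros faces (zero , W) = zeros W
≗-by-parts zeros faces (suc k , b ∷ Z) = faces b (k , Z)

module _ {m} {X₀ : Vtx m} {A B : EdgeSet m} where

  glue-bridge : Bridge (glue X₀ A B) X₀
  glue-bridge = mkBridge (dec-true (false ∷ X₀ ≟V false ∷ X₀) refl) only
    where only : OnlyBridge (glue X₀ A B) X₀
          only W t with W ≟V false ∷ X₀
          ... | yes W≡bridge = W≡bridge

  glue-isSpanningTree : IsSpanningTree A → IsSpanningTree B → IsSpanningTree (glue X₀ A B)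
  glue-isSpanningTree (edgesA , connectedA , acyclicA) (edgesB , connectedB , acyclicB) =
    edges ,
    bridge-connected {X₀ = X₀} (Bridge.edge glue-bridge) connected ,
    bridge-acyclic {X₀ = X₀} (Bridge.unique glue-bridge) acyclic
    where
    edges : ∀ e → glue X₀ A B e ≡ true → IsEdge e
    edges (zero , W) t with refl ← Bridge.unique glue-bridge W t = refl
    edges (suc k , false ∷ Z) = edgesA (k , Z)
    edges (suc k , true ∷ Z) = edgesB (k , Z)
    connected : ∀ b → Connected (face b (glue X₀ A B))
    connected false = connectedA
    connected true = connectedB
    acyclic : ∀ b → Acyclic (face b (glue X₀ A B))
    acyclic false = acyclicA
    acyclic true = acyclicB

  sig-glue : sig (glue X₀ A B) ≡ 1 ∷ (sig A +ᵛ sig B)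
  sig-glue = trans (sig-suc (glue X₀ A B)) (cong (_∷ (sig A +ᵛ sig B)) (count-≟ (false ∷ X₀)))

glue-cong : ∀ {m} {X₀ X₀′ : Vtx m} {A A′ B B′} →
  X₀ ≡ X₀′ → A ≗ A′ → B ≗ B′ → glue X₀ A B ≗ glue X₀′ A′ B′
glue-cong refl A≗A′ B≗B′ = ≗-by-parts (λ W → refl) λ where
  false → A≗A′
  true → B≗B′

module _ {m} {T : EdgeSet (suc m)} {X₀ : Vtx m} (β : Bridge T X₀) where

  bridge-zero-edges : ∀ W → T (zero , W) ≡ glue X₀ (face false T) (face true T) (zero , W)
  bridge-zero-edges W = case W ≟V false ∷ X₀ of λ where
    (yes refl) → trans (Bridge.edge β) (sym (dec-true (W ≟V W) refl))
    (no W≢bridge) → trans (¬-not (W≢bridge ∘ Bridge.unique β W)) (sym (dec-false (W ≟V false ∷ X₀) W≢bridge))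

  glue-faces : glue X₀ (face false T) (face true T) ≗ T
  glue-faces = ≗-by-parts (sym ∘ bridge-zero-edges) λ where
    false _ → refl
    true _ → refl

bridges-agree : ∀ {m} {T T′ : EdgeSet (suc m)} {X₀} →
  Bridge T X₀ → Bridge T′ X₀ → ∀ W → T (zero , W) ≡ T′ (zero , W)
bridges-agree β β′ W = trans (bridge-zero-edges β W) (sym (bridge-zero-edges β′ W))

∃-bridge : ∀ {m} {T : EdgeSet (suc m)} → IsSpanningTree T → head (sig T) ≡ 1 → ∃ (Bridge T)
∃-bridge {m} {T} (edges , _) one with filterᵇ-witness (λ W → T (zero , W)) (allVtx (suc m)) one
... | true ∷ Z , t = case edges (zero , true ∷ Z) t of λ ()
... | false ∷ X₀ , t = X₀ , mkBridge t λ W t′ → count≡1-unique {p = λ W → T (zero , W)} one t′ t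

-- Edge slides of bridged trees

Q□ℰ² : ℕ → Graph
Q□ℰ² m = Q m □ (ℰ m □ ℰ m)

FaceTrees : ∀ {m} → EdgeSet (suc m) → Set
FaceTrees T = ∀ b → IsSpanningTree (face b T)

faceSplit : ∀ {m} → Vtx m → (T : EdgeSet (suc m)) → FaceTrees T → Carrier (Q□ℰ² m)
faceSplit X₀ T τ = X₀ , (face false T , τ false) , (face true T , τ true)

-- The other face of T already joins X and σ_j X, and all of its edges survive in T′ − f.
cross-face-slide-impossible : ∀ {m} {T T′ : EdgeSet (suc m)} {b j X} →
  Connected (face (not b) T) → Acyclic (face (not b) T′) → T (inFace (not b) (j , X)) ≡ false →
  T′ ≗ swap T (inFace b (j , X)) (inFace (not b) (j , X)) → ⊥
cross-face-slide-impossible {T = T} {T′} {b} {j} {X} connected acyclic Tf T′≗ =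
  acyclic (j , X) (slide-new T T′≗) (reach-mono keptEdges (connected X (σ j X)))
  where
  keptEdges : ∀ g → face (not b) T g ≡ true → remove (face (not b) T′) (j , X) g ≡ true
  keptEdges g t = trans (remove-other (face (not b) T′) g≢jX)
    (trans (slide-away T {x = inFace (not b) g} T′≗
             (inFace-≢ (not-¬ refl ∘ sym)) (g≢jX ∘ inFace-injective (not b))) t)
    where g≢jX : g ≢ (j , X)
          g≢jX refl = case trans (sym Tf) t of λ ()

module _ {m} {T : EdgeSet (suc m)} {X₀ : Vtx m} (β : Bridge T X₀) where

  swap-bridge : ∀ X₀′ → Bridge (swap T (zero , false ∷ X₀) (zero , false ∷ X₀′)) X₀′
  swap-bridge X₀′ = mkBridge (swap-new T (zero , false ∷ X₀) (zero , false ∷ X₀′)) only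
    where only : OnlyBridge (swap T (zero , false ∷ X₀) (zero , false ∷ X₀′)) X₀′
          only W s with swap-true T {zero , false ∷ X₀} {zero , false ∷ X₀′} {zero , W} s
          ... | inj₁ refl = refl
          ... | inj₂ (≢bridge , t) = ⊥-elim (≢bridge (cong (zero ,_) (Bridge.unique β W t)))

  module _ {T′ : EdgeSet (suc m)} where

    bridge-move⇒slide : ∀ {i} → Bridge T′ (σ i X₀) → (∀ b → face b T ≗ face b T′) → Slide T T′
    bridge-move⇒slide {i} β′ sameFaces = suc i , e , (λ ()) , Bridge.edge β , notYetBridge , ≗-by-parts zeros faces
      where
      e f : Edge (suc m)
      e = zero , false ∷ X₀
      f = zero , false ∷ σ i X₀
      notYetBridge : T f ≡ false
      notYetBridge = ¬-not (σ-irreflexive i X₀ ∘ ∷-injectiveʳ ∘ Bridge.unique β _)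
      zeros : ∀ W → T′ (zero , W) ≡ swap T e f (zero , W)
      zeros = bridges-agree β′ (swap-bridge (σ i X₀))
      faces : ∀ b → face b T′ ≗ face b (swap T e f)
      faces b x = trans (sym (sameFaces b x)) (sym (swap-other T {e} {f} (λ ()) (λ ())))

    face-slide⇒slide : Bridge T′ X₀ → ∀ b → Slide (face b T) (face b T′) →
      face (not b) T ≗ face (not b) T′ → Slide T T′
    face-slide⇒slide β′ b (i , (j , X) , j≢i , Te , Tf , T′≗) other =
      suc i , e , j≢i ∘ Fin.suc-injective , Te , Tf , ≗-by-parts zeros faces
      where
      e f : Edge (suc m)
      e = inFace b (j , X)
      f = inFace b (j , σ i X)
      zeros : ∀ W → T′ (zero , W) ≡ swap T e f (zero , W)
      zeros W = trans (bridges-agree β′ β W) (sym (swap-other T {e} {f} (λ ()) (λ ())))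
      otherFace : ∀ {c} → c ≢ b → face c T′ ≗ face c T
      otherFace c≢b rewrite ¬-not c≢b = sym ∘ other
      faces : ∀ c → face c T′ ≗ face c (swap T e f)
      faces c x = case c ≟B b of λ where
        (yes refl) → trans (T′≗ x) (sym (swap-∘ (inFace-injective b) T (j , X) (j , σ i X) x))
        (no c≢b) → trans (otherFace c≢b x) (sym (swap-other T {e} {f} (inFace-≢ c≢b) (inFace-≢ c≢b)))

module _ {m} {T T′ : EdgeSet (suc m)} {X₀ X₀′ : Vtx m} (β : Bridge T X₀) (β′ : Bridge T′ X₀′) where

  private
    Adjacent : FaceTrees T → FaceTrees T′ → Set
    Adjacent τ τ′ = Adj (Q□ℰ² m) (faceSplit X₀ T τ) (faceSplit X₀′ T′ τ′)

  slide-in-face : ∀ {i b j X} → suc j ≢ suc i → T (inFace b (j , X)) ≡ true → T (inFace b (j , σ i X)) ≡ false →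
    T′ ≗ swap T (inFace b (j , X)) (inFace b (j , σ i X)) →
    X₀ ≡ X₀′ × Slide (face b T) (face b T′) × face (not b) T ≗ face (not b) T′
  slide-in-face {i} {b} {j} {X} j≢i Te Tf T′≗ =
    ∷-injectiveʳ (Bridge.unique β′ _ (trans (slide-away T T′≗ (λ ()) (λ ())) (Bridge.edge β))) ,
    (i , (j , X) , j≢i ∘ cong suc , Te , Tf ,
      λ x → trans (T′≗ (inFace b x)) (swap-∘ (inFace-injective b) T (j , X) (j , σ i X) x)) ,
    λ x → sym (slide-away T T′≗ (inFace-≢ (not-¬ refl ∘ sym)) (inFace-≢ (not-¬ refl ∘ sym)))

  slide⇒adjacent : IsSpanningTree T → IsSpanningTree T′ → Slide T T′ → ∀ {τ τ′} → Adjacent τ τ′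
  slide⇒adjacent _ _ (i , (zero , W) , i≢0 , Te , Tf , T′≗) with refl ← Bridge.unique β W Te | i
  ... | zero = ⊥-elim (i≢0 refl)
  ... | suc i′ = inj₁ ((i′ , X₀′≡σX₀) , faceUnchanged , faceUnchanged)
    where
    X₀′≡σX₀ : X₀′ ≡ σ i′ X₀
    X₀′≡σX₀ = sym (∷-injectiveʳ (Bridge.unique β′ _ (slide-new T T′≗)))
    faceUnchanged : ∀ {b} → face b T ≗ face b T′
    faceUnchanged x = sym (slide-away T T′≗ (λ ()) (λ ()))
  slide⇒adjacent (_ , connected , _) (_ , _ , acyclic′) (zero , (suc j , b ∷ X) , _ , Te , Tf , T′≗) =
    ⊥-elim (cross-face-slide-impossible (face-connected connected (Bridge.unique β) (not b))
      (face-acyclic acyclic′ (not b)) Tf T′≗)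
  slide⇒adjacent _ _ (suc i , (suc j , false ∷ X) , j≢i , Te , Tf , T′≗) =
    let (X₀≡X₀′ , slide , other) = slide-in-face j≢i Te Tf T′≗
    in inj₂ (X₀≡X₀′ , inj₁ (inj₁ slide , other))
  slide⇒adjacent _ _ (suc i , (suc j , true ∷ X) , j≢i , Te , Tf , T′≗) =
    let (X₀≡X₀′ , slide , other) = slide-in-face j≢i Te Tf T′≗
    in inj₂ (X₀≡X₀′ , inj₂ (other , inj₁ slide))

  adjacent⇒slide : ∀ {τ τ′} → Adjacent τ τ′ → Slide T T′ ⊎ Slide T′ T
  adjacent⇒slide (inj₁ ((i , refl) , A≗ , B≗)) = inj₁ (bridge-move⇒slide β β′ λ where
    false → A≗
    true → B≗)
  adjacent⇒slide (inj₂ (refl , inj₁ (inj₁ s , B≗))) = inj₁ (face-slide⇒slide β β′ false s B≗)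
  adjacent⇒slide (inj₂ (refl , inj₁ (inj₂ s , B≗))) = inj₂ (face-slide⇒slide β′ β false s (sym ∘ B≗))
  adjacent⇒slide (inj₂ (refl , inj₂ (A≗ , inj₁ s))) = inj₁ (face-slide⇒slide β β′ true s A≗)
  adjacent⇒slide (inj₂ (refl , inj₂ (A≗ , inj₂ s))) = inj₂ (face-slide⇒slide β′ β true s (sym ∘ A≗))

sigs : ∀ {m} → Carrier (Q□ℰ² m) → Vec ℕ m × Vec ℕ m
sigs (_ , (A , _) , (B , _)) = sig A , sig B

sigs-realised : ∀ {m} (t : Carrier (Q□ℰ² m)) → InSig m (proj₁ (sigs t)) × InSig m (proj₂ (sigs t))
sigs-realised (_ , A , B) = (A , refl) , (B , refl)

module _ {m : ℕ} where

  Q□ℰ²-symmetric : Symmetric (Adj (Q□ℰ² m))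
  Q□ℰ²-symmetric (inj₁ (move , A≗ , B≗)) = inj₁ (Q-symmetric move , sym ∘ A≗ , sym ∘ B≗)
  Q□ℰ²-symmetric (inj₂ (X≡ , inj₁ (slide , B≗))) = inj₂ (sym X≡ , inj₁ (Sum.swap slide , sym ∘ B≗))
  Q□ℰ²-symmetric (inj₂ (X≡ , inj₂ (A≗ , slide))) = inj₂ (sym X≡ , inj₂ (sym ∘ A≗ , Sum.swap slide))

  decompose : (T : SpanningTree (suc m)) → ∃ (Bridge (proj₁ T)) → Carrier (Q□ℰ² m)
  decompose (T , tree) (X₀ , β) = faceSplit X₀ T (face-isSpanningTree tree (Bridge.unique β))

  glueTree : Carrier (Q□ℰ² m) → SpanningTree (suc m)
  glueTree (X₀ , (A , treeA) , (B , treeB)) = glue X₀ A B , glue-isSpanningTree treeA treeB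

  sig-glueTree : ∀ t → sig (proj₁ (glueTree t)) ≡ 1 ∷ (proj₁ (sigs t) +ᵛ proj₂ (sigs t))
  sig-glueTree (X₀ , (A , _) , (B , _)) = sig-glue {X₀ = X₀} {A} {B}

  module _ (T T′ : SpanningTree (suc m)) {X₀ X₀′}
           (β : Bridge (proj₁ T) X₀) (β′ : Bridge (proj₁ T′) X₀′) where

    decompose-cong : proj₁ T ≗ proj₁ T′ →
      Graph._≈_ (Q□ℰ² m) (decompose T (X₀ , β)) (decompose T′ (X₀′ , β′))
    decompose-cong T≗T′ =
      ∷-injectiveʳ (Bridge.unique β′ _ (trans (sym (T≗T′ (zero , false ∷ X₀))) (Bridge.edge β))) ,
      T≗T′ ∘ inFace false , T≗T′ ∘ inFace true

    decompose-adjacent :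
      Adj (ℰ (suc m)) T T′ ⇔ Adj (Q□ℰ² m) (decompose T (X₀ , β)) (decompose T′ (X₀′ , β′))
    decompose-adjacent = mk⇔
      (λ where
        (inj₁ s) → slide⇒adjacent β β′ (proj₂ T) (proj₂ T′) s {τ} {τ′}
        (inj₂ s) → Q□ℰ²-symmetric {faceSplit X₀′ (proj₁ T′) τ′} {faceSplit X₀ (proj₁ T) τ}
                     (slide⇒adjacent β′ β (proj₂ T′) (proj₂ T) s {τ′} {τ}))
      (adjacent⇒slide β β′ {τ} {τ′})
      where
      τ = face-isSpanningTree (proj₂ T) (Bridge.unique β)
      τ′ = face-isSpanningTree (proj₂ T′) (Bridge.unique β′)

  decompose-glue : ∀ (T : SpanningTree (suc m)) ((X₀ , β) : ∃ (Bridge (proj₁ T))) t →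
    proj₁ T ≗ proj₁ (glueTree t) → Graph._≈_ (Q□ℰ² m) (decompose T (X₀ , β)) t
  decompose-glue T (X₀ , β) (X , (A , _) , (B , _)) T≗glue =
    sym (∷-injectiveʳ (Bridge.unique β _
      (trans (T≗glue (zero , false ∷ X)) (Bridge.edge (glue-bridge {X₀ = X} {A} {B}))))) ,
    T≗glue ∘ inFace false , T≗glue ∘ inFace true

  glue-decompose : ∀ (T : SpanningTree (suc m)) ((X₀ , β) : ∃ (Bridge (proj₁ T))) t →
    Graph._≈_ (Q□ℰ² m) t (decompose T (X₀ , β)) → proj₁ (glueTree t) ≗ proj₁ T
  glue-decompose T (X₀ , β) t (X≡X₀ , A≗ , B≗) x = trans (glue-cong X≡X₀ A≗ B≗ x) (glue-faces β x)

module _ {m} (P : SpanningTree (suc m) → Set) (P′ : Carrier (Q□ℰ² m) → Set)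
         (bridged : ∀ {T} → P T → head (sig (proj₁ T)) ≡ 1)
         (P⇒P′ : ∀ {T} β → P T → P′ (decompose T β))
         (P′⇒P : ∀ {t} → P′ t → P (glueTree t)) where

  decomposition-≅ : Induced (ℰ (suc m)) P ≅ Induced (Q□ℰ² m) P′
  decomposition-≅ = record
    { bij = record
      { to = λ (T , p) → decompose T (bridgeOf T p) , P⇒P′ (bridgeOf T p) p
      ; from = λ (t , q) → glueTree t , P′⇒P q
      ; to-cong = λ { {T , p} {T′ , p′} → decompose-cong T T′ (proj₂ (bridgeOf T p)) (proj₂ (bridgeOf T′ p′)) }
      ; from-cong = λ (X≡ , A≗ , B≗) → glue-cong X≡ A≗ B≗
      ; inverse = (λ { {t , _} {T , p} → decompose-glue T (bridgeOf T p) t })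
                , (λ { {T , p} {t , _} → glue-decompose T (bridgeOf T p) t })
      }
    ; adj = λ (T , p) (T′ , p′) → decompose-adjacent T T′ (proj₂ (bridgeOf T p)) (proj₂ (bridgeOf T′ p′))
    }
    where bridgeOf : (T : SpanningTree (suc m)) → P T → ∃ (Bridge (proj₁ T))
          bridgeOf T p = ∃-bridge (proj₂ T) (bridged p)

module _ {m : ℕ} where

  sigs-cong : ∀ x y → Graph._≈_ (Q□ℰ² m) x y → sigs x ≡ sigs y
  sigs-cong _ _ (_ , A≗ , B≗) = cong₂ _,_ (sig-cong A≗) (sig-cong B≗)

  sigs-adjacent : ∀ x y → Adj (Q□ℰ² m) x y → sigs x ≡ sigs y
  sigs-adjacent _ _ (inj₁ (_ , A≗ , B≗)) = cong₂ _,_ (sig-cong A≗) (sig-cong B≗)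
  sigs-adjacent (_ , A , _) (_ , A′ , _) (inj₂ (_ , inj₁ (slide , B≗))) =
    cong₂ _,_ (ℰ-adjacent-sig A A′ slide) (sig-cong B≗)
  sigs-adjacent (_ , _ , B) (_ , _ , B′) (inj₂ (_ , inj₂ (A≗ , slide))) =
    cong₂ _,_ (sig-cong A≗) (ℰ-adjacent-sig B B′ slide)

  Q□ℰS² : Vec ℕ m × Vec ℕ m → Graph
  Q□ℰS² (S₁ , S₂) = Q m □ (ℰS m S₁ □ ℰS m S₂)

module _ {m} (P : Vec ℕ m × Vec ℕ m → Set) where

  private
    Split : Graph
    Split = Coprod (Vec ℕ m × Vec ℕ m) P Q□ℰS²

    untag : Carrier Split → Carrier (Q□ℰ² m)
    untag (_ , _ , (X , (A , _) , (B , _))) = X , A , B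

    untag-≈ : ∀ {a b} → Graph._≈_ Split a b → Graph._≈_ (Q□ℰ² m) (untag a) (untag b)
    untag-≈ (ceq r) = r

    untag-adj : ∀ {a b} → Adj Split a b → Adj (Q□ℰ² m) (untag a) (untag b)
    untag-adj (cadj r) = r

    tag-≈ : ∀ {a b} → proj₁ a ≡ proj₁ b → Graph._≈_ (Q□ℰ² m) (untag a) (untag b) → Graph._≈_ Split a b
    tag-≈ {_ , _ , _} {_ , _ , _} refl = ceq

    tag-adj : ∀ {a b} → proj₁ a ≡ proj₁ b → Adj (Q□ℰ² m) (untag a) (untag b) → Adj Split a b
    tag-adj {_ , _ , _} {_ , _ , _} refl = cadj

  signature-split-≅ : Induced (Q□ℰ² m) (P ∘ sigs) ≅ Split
  signature-split-≅ = record
    { bij = record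
      { to = λ ((X , A , B) , p) → sigs (X , A , B) , p , (X , (A , refl) , (B , refl))
      ; from = λ (S , p , (X , (A , eA) , (B , eB))) → (X , A , B) , subst P (sym (cong₂ _,_ eA eB)) p
      ; to-cong = λ { {x , _} {y , _} r → tag-≈ (sigs-cong x y r) r }
      ; from-cong = untag-≈
      ; inverse = (λ { {x@(_ , _ , (_ , (_ , eA) , (_ , eB)))} {y , _} r →
                         tag-≈ (trans (sigs-cong y (untag x) r) (cong₂ _,_ eA eB)) r })
                , untag-≈
      }
    ; adj = λ (x , _) (y , _) → mk⇔ (λ r → tag-adj (sigs-adjacent x y r) r) untag-adj
    }

-- n = suc m with n ≥ 2, i.e. 1 ≤ m; Q_{n-1} = Q m, ℰ_{n-1} = ℰ m
theorem6p16 : ∀ (m : ℕ) → 1 ≤ m →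
    (ℰRed1 m ≅ Q m □ (ℰ m □ ℰ m))
    × (Q m □ (ℰ m □ ℰ m) ≅
        Coprod (Vec ℕ m × Vec ℕ m) (λ { (S₁ , S₂) → InSig m S₁ × InSig m S₂ })
          (λ { (S₁ , S₂) → Q m □ (ℰS m S₁ □ ℰS m S₂) }))
    × (∀ (S′ : Vec ℕ m) → InRed1 m (1 ∷ S′) →
        ℰS (suc m) (1 ∷ S′) ≅
          Coprod (Vec ℕ m × Vec ℕ m)
            (λ { (S₁ , S₂) → InSig m S₁ × InSig m S₂ × (S₁ +ᵛ S₂) ≡ S′ })
            (λ { (S₁ , S₂) → Q m □ (ℰS m S₁ □ ℰS m S₂) }))
theorem6p16 m _ = reduced-≅ , split-≅ , fixedSignature-≅
  where
  SummingTo : Vec ℕ m → Vec ℕ m × Vec ℕ m → Set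
  SummingTo S′ (S₁ , S₂) = InSig m S₁ × InSig m S₂ × (S₁ +ᵛ S₂) ≡ S′

  reduced-≅ : ℰRed1 m ≅ Q□ℰ² m
  reduced-≅ =
    ≅-trans (fibres-≅ (ℰ (suc m)) (sig ∘ proj₁) (InRed1 m) sig-cong (λ {T} {T′} → ℰ-adjacent-sig T T′))
   (≅-trans (decomposition-≅ (InRed1 m ∘ sig ∘ proj₁) (λ _ → ⊤) proj₂ (λ _ _ → tt)
              λ {t} _ → (glueTree t , refl) , cong head (sig-glueTree t))
            (Induced-total-≅ (Q□ℰ² m) (λ _ → tt)))

  split-≅ : Q□ℰ² m ≅ Coprod (Vec ℕ m × Vec ℕ m) (λ (S₁ , S₂) → InSig m S₁ × InSig m S₂) Q□ℰS²
  split-≅ = ≅-trans (≅-Induced-total (Q□ℰ² m) sigs-realised) (signature-split-≅ _)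

  fixedSignature-≅ : ∀ S′ → InRed1 m (1 ∷ S′) →
    ℰS (suc m) (1 ∷ S′) ≅ Coprod (Vec ℕ m × Vec ℕ m) (SummingTo S′) Q□ℰS²
  fixedSignature-≅ S′ _ = ≅-trans
    (decomposition-≅ (λ T → sig (proj₁ T) ≡ 1 ∷ S′) (SummingTo S′ ∘ sigs) (cong head)
      (λ {T} β sigT → let (inA , inB) = sigs-realised (decompose T β)
                      in inA , inB , cong tail (trans (sym (sig-suc (proj₁ T))) sigT))
      λ {t} (_ , _ , sum) → trans (sig-glueTree t) (cong (1 ∷_) sum))
    (signature-split-≅ (SummingTo S′))
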